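{- Let $\vec S$ be a universe of set separations of a set $V$ with the order function $|X,Y|_r=r(X)+r(Y)-r(V)$ for some non-negative non-decreasing submodular function $r:2^V\to\mathbb N$, and let $p\in\mathbb N$. Then $\mathcal F_p=\{\sigma:\sigma$ a star of elements of $\vec S$ with $\langle\sigma\rangle_r<p\}$ is fixed under shifting.
   Context: $\mathrm{sep}(V)=\{(A,B):A\cup B=V\}$ is ordered by $(A,B)\le(C,D)$ iff $A\subseteq C$ and $B\supseteq D$, with involution $(A,B)^*=(B,A)$. A universe of set separations is a subset $\vec S\subseteq\mathrm{sep}(V)$ closed under $*$ and under $(A,B)\wedge(C,D)=(A\cap C,B\cup D)$ and $(A,B)\vee(C,D)=(A\cup C,B\cap D)$. A star is a finite multiset $\sigma$ of separations such that any two of its members (distinct as members of the multiset) $(A,B),(C,D)$ satisfy $(A,B)\le(D,C)$. For a star $\sigma=\{(A_0,B_0),\dots,(A_n,B_n)\}$, $\langle\sigma\rangle_r=\sum_{i=0}^n r(B_i)-n\,r(V)$. For $(A,B)\le(C,D)$, $\lambda((A,B),(C,D))=\min\{|Z,W|_r:(Z,W)\in\vec S,(A,B)\le(Z,W)\le(C,D)\}$, and $(X,Y)$ is linked to $(A,B)$ if $(A,B)\le(X,Y)$ and $|X,Y|_r=\lambda((A,B),(X,Y))$. An $S$-tree is a pair $(T,\alpha)$ with $T$ a finite tree and $\alpha$ a map from the set $\vec E(T)$ of oriented edges $(x,y)$ of $T$ to $\vec S$ with $\alpha(y,x)=\alpha(x,y)^*$. For $t\in V(T)$, $\vec F_t=\{(x,t)\in\vec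 E(T)\}$ and $\sigma_t=\alpha(\vec F_t)$ as a multiset; the tree is tame if every $\sigma_t$ is a star. Oriented edges are ordered by $(x,y)\le(u,v)$ iff they are equal or $T$ contains a path whose vertex sequence begins $x,y$ and ends $u,v$ (with $y=u$ allowed). For $\vec e=(x,y)$, $T(\vec e)$ is the subtree consisting of the component of $T-x$ containing $y$ together with $x$ and the edge $xy$. The shift of $(T,\alpha)$ onto $(X,Y)$ with respect to $\vec e$ (where $\alpha(\vec e)\le(X,Y)$) is $(T(\vec e),\alpha')$ where for each edge $f$ of $T(\vec e)$, with $\vec f$ its orientation satisfying $\vec e\le\vec f$ and $\overleftarrow f$ its reverse, $\alpha'(\vec f)=\alpha(\vec f)\vee(X,Y)$ and $\alpha'(\overleftarrow f)=\alpha(\overleftarrow f)\wedge(Y,X)$. A family $\mathcal F$ of finite multisets of elements of $\vec S$ is fixed under shifting if whenever $\sigma\in\mathcal F$, $(T,\alpha)$ is a tame $S$-tree, $\vec e=(t,t')\in\vec E(T)$, $\sigma=\alpha(\vec F_s)$ for some $s\in V(T(\vec e))\setminus\{t\}$, and $(X,Y)\in\vec S$ is linked to $\alpha(\vec e)$, then in the shift $(T(\vec e),\alpha')$ onto $(X,Y)$ with respect to $\vec e$ we have $\alpha'(\vec F_s)\in\mathcal F$. -}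

module Defs where

open import Data.Nat using (ℕ; _≤_; _+_)
open import Data.Nat.ListAction using (sum)
open import Data.Nat.Properties using ()
open import Data.Integer as ℤ using (ℤ; +_) renaming (_+_ to _+ℤ_; _-_ to _-ℤ_; _*_ to _*ℤ_; _<_ to _<ℤ_; _≤_ to _≤ℤ_)
open import Data.Fin using (Fin)
open import Data.Bool using (Bool; true)
open import Data.Unit using (⊤)
open import Data.Product using (Σ; ∃; _×_; _,_; proj₁; proj₂)
open import Data.Sum using (_⊎_)
open import Data.Maybe using (just)
open import Data.List using (List; []; _∷_; _++_; map; length; lookup; head; last; filterᵇ; allFin)
open import Data.List.Relation.Unary.All using (All)
open import Data.List.Relation.Unary.Linked using (Linked)
open import Data.List.Relation.Unary.Unique.Propositional using (Unique)
open import Data.List.Membership.Propositional using (_∈_; _∉_)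
open import Relation.Binary.PropositionalEquality using (_≡_; _≢_)
open import Relation.Nullary using (¬_)

Subset : Set → Set₁
Subset V = V → Set

_⊆_ : {V : Set} → Subset V → Subset V → Set
A ⊆ B = ∀ v → A v → B v

_≐_ : {V : Set} → Subset V → Subset V → Set
A ≐ B = (A ⊆ B) × (B ⊆ A)

_∩_ : {V : Set} → Subset V → Subset V → Subset V
(A ∩ B) v = A v × B v

_∪_ : {V : Set} → Subset V → Subset V → Subset V
(A ∪ B) v = A v ⊎ B v

Whole : (V : Set) → Subset V
Whole V = λ _ → ⊤

-- a pair (A , B) of subsets; membership in sep(V) is the predicate IsSep
Sep : Set → Set₁
Sep V = Subset V × Subset V

IsSep : {V : Set} → Sep V → Set
IsSep (A , B) = ∀ v → (A ∪ B) v

_≤ˢ_ : {V : Set} → Sep V → Sep V → Set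
(A , B) ≤ˢ (C , D) = (A ⊆ C) × (D ⊆ B)

_* : {V : Set} → Sep V → Sep V
(A , B) * = (B , A)

_∧ˢ_ : {V : Set} → Sep V → Sep V → Sep V
(A , B) ∧ˢ (C , D) = (A ∩ C , B ∪ D)

_∨ˢ_ : {V : Set} → Sep V → Sep V → Sep V
(A , B) ∨ˢ (C , D) = (A ∪ C , B ∩ D)

-- a universe of set separations of V (a set of separations, hence closed
-- under extensional equality of its sides)
record IsUniverse {V : Set} (S : Sep V → Set) : Set₁ where
  field
    ⊆sep  : ∀ s → S s → IsSep s
    ext   : ∀ A B C D → A ≐ C → B ≐ D → S (A , B) → S (C , D)
    *-cl  : ∀ s → S s → S (s *)
    ∧-cl  : ∀ s t → S s → S t → S (s ∧ˢ t)
    ∨-cl  : ∀ s t → S s → S t → S (s ∨ˢ t)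

-- r : 2^V → ℕ, non-decreasing and submodular (non-negativity is automatic
-- in ℕ); r is a function on subsets, hence respects extensional equality
record IsSubmodularRank {V : Set} (r : Subset V → ℕ) : Set₁ where
  field
    r-ext        : ∀ A B → A ≐ B → r A ≡ r B
    monotone     : ∀ A B → A ⊆ B → r A ≤ r B
    submodular   : ∀ A B → r (A ∩ B) + r (A ∪ B) ≤ r A + r B

∣_∣[_] : {V : Set} → Sep V → (Subset V → ℕ) → ℤ
∣_∣[_] {V} (X , Y) r = (+ r X +ℤ + r Y) -ℤ + r (Whole V)

-- Stars (finite multisets, represented as lists) and ⟨σ⟩_r

IsStar : {V : Set} → List (Sep V) → Set
IsStar σ = ∀ i j → i ≢ j → lookup σ i ≤ˢ (lookup σ j *)

⟨_⟩[_] : {V : Set} → List (Sep V) → (Subset V → ℕ) → ℤ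
⟨_⟩[_] {V} σ r = + sum (map (λ s → r (proj₂ s)) σ) -ℤ ((+ length σ -ℤ + 1) *ℤ + r (Whole V))

Fp : {V : Set} → (S : Sep V → Set) → (Subset V → ℕ) → ℕ → List (Sep V) → Set₁
Fp S r p σ = All S σ × IsStar σ × (⟨ σ ⟩[ r ] <ℤ + p)

Linked-to : {V : Set} → (S : Sep V → Set) → (Subset V → ℕ) → Sep V → Sep V → Set₁
Linked-to S r XY AB =
  AB ≤ˢ XY × (∀ ZW → S ZW → AB ≤ˢ ZW → ZW ≤ˢ XY → ∣ XY ∣[ r ] ≤ℤ ∣ ZW ∣[ r ])

Adj : {n : ℕ} → (Fin n → Fin n → Bool) → Fin n → Fin n → Set
Adj adj x y = adj x y ≡ true

IsPath : {n : ℕ} → (Fin n → Fin n → Bool) → List (Fin n) → Set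
IsPath adj ps = Unique ps × Linked (Adj adj) ps

PathFromTo : {n : ℕ} → (Fin n → Fin n → Bool) → Fin n → Fin n → List (Fin n) → Set
PathFromTo adj x y ps = IsPath adj ps × head ps ≡ just x × last ps ≡ just y

HasCycle : {n : ℕ} → (Fin n → Fin n → Bool) → Set
HasCycle adj = ∃ λ x → ∃ λ y → ∃ λ ps →
  PathFromTo adj x y ps × 3 ≤ length ps × Adj adj y x

record IsTree {n : ℕ} (adj : Fin n → Fin n → Bool) : Set where
  field
    symmetric   : ∀ x y → adj x y ≡ adj y x
    irreflexive : ∀ x → ¬ Adj adj x x
    connected   : ∀ x y → ∃ λ ps → PathFromTo adj x y ps
    acyclic     : ¬ HasCycle adj

-- neighbours x of t, i.e. the oriented edges (x,t) ∈ F⃗_t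
nbrs : {n : ℕ} → (Fin n → Fin n → Bool) → Fin n → List (Fin n)
nbrs {n} adj t = filterᵇ (λ x → adj x t) (allFin n)

σ[_,_] : {n : ℕ} {V : Set} → (Fin n → Fin n → Bool) → (Fin n → Fin n → Sep V) → Fin n → List (Sep V)
σ[_,_] adj α t = map (λ x → α x t) (nbrs adj t)

record IsTameSTree {n : ℕ} {V : Set} (S : Sep V → Set)
       (adj : Fin n → Fin n → Bool) (α : Fin n → Fin n → Sep V) : Set₁ where
  field
    tree   : IsTree adj
    inS    : ∀ x y → Adj adj x y → S (α x y)
    invol  : ∀ x y → Adj adj x y → α y x ≡ (α x y) *
    tame   : ∀ t → IsStar (σ[ adj , α ] t)

EdgeLe : {n : ℕ} → (Fin n → Fin n → Bool) → Fin n × Fin n → Fin n × Fin n → Set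
EdgeLe adj (x , y) (u , v) =
  (x ≡ u × y ≡ v) ⊎
  (∃ λ ps → IsPath adj ps × (∃ λ rest → ps ≡ x ∷ y ∷ rest) × (∃ λ ini → ps ≡ ini ++ (u ∷ v ∷ [])))

-- the component of T − t containing t'
InComp : {n : ℕ} → (Fin n → Fin n → Bool) → Fin n → Fin n → Fin n → Set
InComp adj t t' z = ∃ λ ps → PathFromTo adj t' z ps × t ∉ ps

VT : {n : ℕ} → (Fin n → Fin n → Bool) → Fin n → Fin n → Fin n → Set
VT adj t t' z = z ≡ t ⊎ InComp adj t t' z

EdgeT : {n : ℕ} → (Fin n → Fin n → Bool) → Fin n → Fin n → Fin n → Fin n → Set
EdgeT adj t t' a b = Adj adj a b ×
  ((InComp adj t t' a × InComp adj t t' b) ⊎ (a ≡ t × b ≡ t') ⊎ (a ≡ t' × b ≡ t))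

-- σ is the value α'(a,b) of the shift of (T,α) onto XY w.r.t. e = (t,t')
ShiftVal : {n : ℕ} {V : Set} → (Fin n → Fin n → Bool) → (Fin n → Fin n → Sep V) →
           Fin n → Fin n → Sep V → Fin n → Fin n → Sep V → Set₁
ShiftVal adj α t t' XY a b σ =
  (EdgeLe adj (t , t') (a , b) × σ ≡ (α a b ∨ˢ XY)) ⊎
  (EdgeLe adj (t , t') (b , a) × σ ≡ (α a b ∧ˢ (XY *)))

-- Let s ≠ t be a vertex of T(e), e = (t , t'), and x₀ the neighbour of s on the path from t. In the shift
-- onto (X , Y), the separation σ₀ = (A₀ , B₀) = α(x₀ , s) is replaced by σ₀ ∨ (X , Y) and every other
-- (Aᵢ , Bᵢ) = α(xᵢ , s) by (Aᵢ , Bᵢ) ∧ (Y , X). The result is again a star, since only one member is moved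
-- up. For the bound on ⟨σ⟩ two inequalities are added:
--   * tameness gives α(t , t') ≤ σ₀, so (X ∩ A₀ , Y ∪ B₀) lies between α(t , t') and (X , Y); linkedness and
--     submodularity on B₀ , Y then give r(B₀ ∩ Y) + r(X) ≤ r(X ∩ A₀) + r(B₀);
--   * as Aⱼ ⊆ Bᵢ for distinct members, submodularity applied to B₁, B₂, … in turn telescopes to
--     Σᵢ r(Bᵢ ∪ X) + r(X ∩ A₀) ≤ Σᵢ r(Bᵢ) + r(X).
-- The tree facts needed (x₀ is unique, and no edge at s is above (t , t') in both orientations) all come
-- from the uniqueness of paths in a tree.

module Submission where

open import Defs
open import Data.Nat using (ℕ; suc; _+_; _≤_; s≤s; z≤n)
import Data.Nat.Properties as ℕ
open import Data.Nat.Tactic.RingSolver using (solve-∀)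
open import Data.Nat.ListAction using (sum)
open import Data.Nat.ListAction.Properties using (sum-↭)
import Data.Integer as ℤ
import Data.Integer.Properties as ℤ
import Data.Integer.Tactic.RingSolver as ℤ-Solver
open import Data.Fin using (Fin; zero; suc; _≟_)
import Data.Fin.Properties as Fin
open import Data.Bool using (Bool)
open import Data.Bool.Properties using (T-≡)
open import Data.Product using (∃; _×_; _,_; proj₁; proj₂)
open import Data.Sum using (_⊎_; inj₁; inj₂)
import Data.Sum
open import Data.Maybe using (just)
open import Data.Maybe.Properties using (just-injective)
open import Data.Maybe.Relation.Binary.Connected as Connected
  using (Connected; just; nothing-just; nothing; drop-just)
open import Function using (_∘_; _∘′_; id; Equivalence; mk⇔)
open import Data.List using (List; []; _∷_; _++_; _∷ʳ_; [_]; map; length; head; last; reverse; allFin)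
open import Data.List.Properties
  using (length-map; map-∘; ++-assoc; reverse-++; unfold-reverse; ∷ʳ-injective; ∷-injectiveˡ; ∷-injectiveʳ)
open import Data.List.Relation.Unary.All as All using (All; []; _∷_)
import Data.List.Relation.Unary.All.Properties as All
open import Data.List.Relation.Unary.AllPairs as AllPairs using (AllPairs; []; _∷_)
import Data.List.Relation.Unary.AllPairs.Properties as AllPairs
open import Data.List.Relation.Unary.Any using (here; there; index)
open import Data.List.Relation.Unary.Any.Properties using (lookup-index)
open import Data.List.Relation.Unary.Linked as Linked using (Linked; []; [-]; _∷_; _∷′_)
import Data.List.Relation.Unary.Linked.Properties as Linked
open import Data.List.Relation.Unary.Unique.Propositional using (Unique)
import Data.List.Relation.Unary.Unique.Propositional.Properties as Unique
import Data.List.Relation.Unary.First as First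
import Data.List.Relation.Unary.First.Properties as First
open import Data.List.Relation.Binary.Disjoint.Propositional using (Disjoint)
open import Data.List.Relation.Binary.Pointwise as Pointwise using (Pointwise; []; _∷_)
open import Data.List.Relation.Binary.Permutation.Propositional
  using (_↭_; ↭-refl; ↭-prep; ↭-swap; ↭-trans; ↭-sym; ↭-reflexive; ↭⇒↭ₛ)
import Data.List.Relation.Binary.Permutation.Propositional.Properties as ↭
import Data.List.Relation.Binary.Permutation.Setoid.Properties as ↭ₛ
open import Data.List.Relation.Binary.BagAndSetEquality using (∼bag⇒↭)
open import Data.List.Membership.Propositional using (_∈_; _∉_)
open import Data.List.Membership.Propositional.Properties
  using (∈-lookup; ∈-∃++; ∈-++⁺ˡ; ∈-++⁺ʳ; ∈-++⁻; ∈-filter⁺; ∈-filter⁻; ∈-allFin)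
open import Data.List.Membership.Propositional.Properties.WithK using (unique∧set⇒bag)
open import Relation.Binary.Core using (Rel)
open import Relation.Binary.Definitions using (Symmetric; DecidableEquality)
open import Relation.Binary.PropositionalEquality
  using (_≡_; _≢_; refl; sym; trans; cong; cong₂; subst; subst₂; resp₂; setoid; module ≡-Reasoning)
open import Relation.Nullary using (Dec; yes; no)
open import Relation.Nullary.Decidable using (T?)
open import Data.Empty using (⊥; ⊥-elim)

-- Lists

module _ {a} {A : Set a} where

  last-++-∷ : ∀ (xs : List A) y ys → last (xs ++ y ∷ ys) ≡ last (y ∷ ys)
  last-++-∷ []           _ _  = refl
  last-++-∷ (_ ∷ [])     _ _  = refl
  last-++-∷ (_ ∷ x ∷ xs) y ys = last-++-∷ (x ∷ xs) y ys

  last-∷ʳ : ∀ (xs : List A) y → last (xs ∷ʳ y) ≡ just y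
  last-∷ʳ xs y = last-++-∷ xs y []

  last-reverse : ∀ (xs : List A) → last (reverse xs) ≡ head xs
  last-reverse []       = refl
  last-reverse (x ∷ xs) =
    subst (λ ys → last ys ≡ just x) (sym (unfold-reverse x xs)) (last-∷ʳ (reverse xs) x)

  ∃-last : ∀ (x : A) xs → ∃ λ z → last (x ∷ xs) ≡ just z
  ∃-last x []       = x , refl
  ∃-last _ (y ∷ ys) = ∃-last y ys

  last-view : ∀ {xs : List A} {z} → last xs ≡ just z → ∃ λ ys → xs ≡ ys ∷ʳ z
  last-view {_ ∷ []}     refl = [] , refl
  last-view {x ∷ y ∷ xs} eq   with last-view {y ∷ xs} eq
  ... | ys , y∷xs≡ = x ∷ ys , cong (x ∷_) y∷xs≡

  ∈-last : ∀ {xs : List A} {z} → last xs ≡ just z → z ∈ xs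
  ∈-last {_ ∷ []}    refl = here refl
  ∈-last {_ ∷ _ ∷ _} eq   = there (∈-last eq)

  head-++ : ∀ (xs : List A) ys {x} → head xs ≡ just x → head (xs ++ ys) ≡ just x
  head-++ (_ ∷ _) _ eq = eq

  head-∷ʳ-++ : ∀ (xs : List A) y ys → head ((xs ∷ʳ y) ++ ys) ≡ head (xs ∷ʳ y)
  head-∷ʳ-++ []      _ _ = refl
  head-∷ʳ-++ (_ ∷ _) _ _ = refl

  nonempty-length : ∀ (xs : List A) y ys → 1 ≤ length (xs ++ y ∷ ys)
  nonempty-length []      _ _ = s≤s z≤n
  nonempty-length (_ ∷ _) _ _ = s≤s z≤n

  singleton≢++-pair : ∀ ini {x u v : A} → x ∷ [] ≢ ini ++ u ∷ v ∷ []
  singleton≢++-pair []          ()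
  singleton≢++-pair (_ ∷ [])    ()
  singleton≢++-pair (_ ∷ _ ∷ _) ()

  first-common : DecidableEquality A → ∀ {z} {xs ys : List A} → z ∈ xs → z ∈ ys →
    First.FirstView (_∉ ys) (_∈ ys) xs
  first-common _≟_ {xs = xs} {ys} z∈xs z∈ys with First.first (λ x → split (x ∈? ys)) xs
    where
    open import Data.List.Membership.DecPropositional _≟_ using (_∈?_)
    split : ∀ {x} → Dec (x ∈ ys) → x ∉ ys ⊎ x ∈ ys
    split (yes x∈) = inj₂ x∈
    split (no x∉)  = inj₁ x∉
  ... | inj₁ first = First.toView first
  ... | inj₂ all∉  = ⊥-elim (All.lookup all∉ z∈xs z∈ys)

  module _ {ℓ} {R : Rel A ℓ} where

    AllPairs-++⁻ : ∀ xs {ys} → AllPairs R (xs ++ ys) →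
      AllPairs R xs × All (λ x → All (R x) ys) xs × AllPairs R ys
    AllPairs-++⁻ []       ys!        = [] , [] , ys!
    AllPairs-++⁻ (x ∷ xs) (x~ ∷ xs!) with AllPairs-++⁻ xs xs!
    ... | xs! , xs~ys , ys! = All.++⁻ˡ xs x~ ∷ xs! , All.++⁻ʳ xs x~ ∷ xs~ys , ys!

    AllPairs-∈ : Symmetric R → ∀ {xs x y} → AllPairs R xs → x ∈ xs → y ∈ xs → x ≢ y → R x y
    AllPairs-∈ R-sym (_ ∷ _)   (here refl) (here refl) x≢x = ⊥-elim (x≢x refl)
    AllPairs-∈ R-sym (x~ ∷ _)  (here refl) (there y∈)  _   = All.lookup x~ y∈
    AllPairs-∈ R-sym (x~ ∷ _)  (there x∈)  (here refl) _   = R-sym (All.lookup x~ x∈)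
    AllPairs-∈ R-sym (_ ∷ xs!) (there x∈)  (there y∈)  x≢y = AllPairs-∈ R-sym xs! x∈ y∈ x≢y

    Linked-++⁻ : ∀ xs {ys} → Linked R (xs ++ ys) →
      Linked R xs × Connected R (last xs) (head ys) × Linked R ys
    Linked-++⁻ [] {[]}    _   = [] , nothing , []
    Linked-++⁻ [] {_ ∷ _} ys~ = [] , nothing-just , ys~
    Linked-++⁻ (x ∷ [])     x∷ys~       = [-] , Linked.head′ x∷ys~ , Linked.tail x∷ys~
    Linked-++⁻ (x ∷ y ∷ xs) (x~y ∷ xs~) with Linked-++⁻ (y ∷ xs) xs~
    ... | xs~′ , xs~ys , ys~ = x~y ∷ xs~′ , xs~ys , ys~

    Linked-reverse⁺ : Symmetric R → ∀ {xs} → Linked R xs → Linked R (reverse xs)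
    Linked-reverse⁺ R-sym {[]}     []    = []
    Linked-reverse⁺ R-sym {x ∷ xs} x∷xs~ =
      subst (Linked R) (sym (unfold-reverse x xs))
        (Linked.++⁺ (Linked-reverse⁺ R-sym (Linked.tail x∷xs~))
          (subst (λ m → Connected R m (just x)) (sym (last-reverse xs))
            (Connected.sym R-sym (Linked.head′ x∷xs~)))
          [-])

module _ {a b} {A : Set a} {B : Set b} {f g : A → B} {x₀ : A} where

  private
    Pivot : A → B → Set _
    Pivot x y = (x ≡ x₀ × y ≡ f x) ⊎ (x ≢ x₀ × y ≡ g x)

    off-pivot : ∀ {xs ys} → All (x₀ ≢_) xs → Pointwise Pivot xs ys → ys ≡ map g xs
    off-pivot []          []                      = refl
    off-pivot (x₀≢x ∷ _)  (inj₁ (x≡x₀ , _) ∷ _)   = ⊥-elim (x₀≢x (sym x≡x₀))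
    off-pivot (_ ∷ x₀≢xs) (inj₂ (_ , refl) ∷ xs~) = cong (g _ ∷_) (off-pivot x₀≢xs xs~)

  pivot-↭ : ∀ {xs ys} → x₀ ∈ xs → Unique xs → Pointwise Pivot xs ys →
    ∃ λ zs → xs ↭ x₀ ∷ zs × ys ↭ f x₀ ∷ map g zs
  pivot-↭ {_ ∷ xs} _ (x₀≢xs ∷ _) (inj₁ (refl , refl) ∷ xs~) =
    xs , ↭-refl , ↭-reflexive (cong (f x₀ ∷_) (off-pivot x₀≢xs xs~))
  pivot-↭ (here refl) _ (inj₂ (x₀≢x₀ , _) ∷ _) = ⊥-elim (x₀≢x₀ refl)
  pivot-↭ {x ∷ _} (there x₀∈xs) (_ ∷ xs!) (inj₂ (_ , refl) ∷ xs~) with pivot-↭ x₀∈xs xs! xs~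
  ... | zs , xs↭ , ys↭ =
    x ∷ zs ,
    ↭-trans (↭-prep x xs↭) (↭-swap x x₀ ↭-refl) ,
    ↭-trans (↭-prep (g x) ys↭) (↭-swap (g x) (f x₀) ↭-refl)

-- Separations and stars

private
  variable
    V : Set

_⇄_ : Sep V → Sep V → Set
σ ⇄ τ = σ ≤ˢ (τ *)

⇄-sym : {σ τ : Sep V} → σ ⇄ τ → τ ⇄ σ
⇄-sym (A⊆D , C⊆B) = C⊆B , A⊆D

≤ˢ-refl : {σ : Sep V} → σ ≤ˢ σ
≤ˢ-refl = (λ _ a → a) , (λ _ b → b)

≤ˢ-trans : {ρ σ τ : Sep V} → ρ ≤ˢ σ → σ ≤ˢ τ → ρ ≤ˢ τ
≤ˢ-trans (A⊆C , D⊆B) (C⊆E , F⊆D) = (λ v → C⊆E v ∘′ A⊆C v) , (λ v → D⊆B v ∘′ F⊆D v)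

∧ˢ-≤ˡ : (σ τ : Sep V) → (σ ∧ˢ τ) ≤ˢ σ
∧ˢ-≤ˡ _ _ = (λ _ → proj₁) , (λ _ → inj₁)

∧ˢ-greatest : {ρ σ τ : Sep V} → ρ ≤ˢ σ → ρ ≤ˢ τ → ρ ≤ˢ (σ ∧ˢ τ)
∧ˢ-greatest (A⊆C , D⊆B) (A⊆E , F⊆B) =
  (λ v a → A⊆C v a , A⊆E v a) , (λ { v (inj₁ d) → D⊆B v d ; v (inj₂ f) → F⊆B v f })

≤ˢ-∨ˢˡ : (σ τ : Sep V) → σ ≤ˢ (σ ∨ˢ τ)
≤ˢ-∨ˢˡ _ _ = (λ _ → inj₁) , (λ _ → proj₁)

∨ˢ-monoˡ : {σ σ′ : Sep V} (τ : Sep V) → σ ≤ˢ σ′ → (σ ∨ˢ τ) ≤ˢ (σ′ ∨ˢ τ)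
∨ˢ-monoˡ _ (A⊆C , D⊆B) =
  (λ { v (inj₁ a) → inj₁ (A⊆C v a) ; v (inj₂ x) → inj₂ x }) , (λ v (d , y) → D⊆B v d , y)

IsStar⇒AllPairs : {σ : List (Sep V)} → IsStar σ → AllPairs _⇄_ σ
IsStar⇒AllPairs {σ = []}    _    = []
IsStar⇒AllPairs {σ = _ ∷ σ} star =
  All.tabulate (λ τ∈σ → subst (_ ⇄_) (sym (lookup-index τ∈σ)) (star zero (suc (index τ∈σ)) λ ())) ∷
  IsStar⇒AllPairs (λ i j i≢j → star (suc i) (suc j) (i≢j ∘′ Fin.suc-injective))

AllPairs⇒IsStar : {σ : List (Sep V)} → AllPairs _⇄_ σ → IsStar σ
AllPairs⇒IsStar (_ ∷ _)   zero    zero    0≢0 = ⊥-elim (0≢0 refl)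
AllPairs⇒IsStar (τ⇄σ ∷ _) zero    (suc j) _   = All.lookup τ⇄σ (∈-lookup j)
AllPairs⇒IsStar (τ⇄σ ∷ _) (suc i) zero    _   = ⇄-sym (All.lookup τ⇄σ (∈-lookup i))
AllPairs⇒IsStar (_ ∷ σ!)  (suc i) (suc j) i≢j = AllPairs⇒IsStar σ! i j (i≢j ∘′ cong suc)

rightRankSum : (Subset V → ℕ) → List (Sep V) → ℕ
rightRankSum r σ = sum (map (λ s → r (proj₂ s)) σ)

⟨⟩-mono : (r : Subset V → ℕ) {σ τ : List (Sep V)} → length σ ≡ length τ →
  rightRankSum r σ ≤ rightRankSum r τ → ⟨ σ ⟩[ r ] ℤ.≤ ⟨ τ ⟩[ r ]
⟨⟩-mono {V} r {τ = τ} |σ|≡|τ| Σσ≤Στ rewrite |σ|≡|τ| =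
  ℤ.+-monoˡ-≤ (ℤ.- ((ℤ.+ length τ ℤ.- ℤ.+ 1) ℤ.* ℤ.+ r (Whole V))) (ℤ.+≤+ Σσ≤Στ)

⟨⟩-resp-↭ : (r : Subset V → ℕ) {σ τ : List (Sep V)} → σ ↭ τ → ⟨ σ ⟩[ r ] ≡ ⟨ τ ⟩[ r ]
⟨⟩-resp-↭ {V} r σ↭τ =
  cong₂ (λ Σ ℓ → ℤ.+ Σ ℤ.- ((ℤ.+ ℓ ℤ.- ℤ.+ 1) ℤ.* ℤ.+ r (Whole V)))
        (sum-↭ (↭.map⁺ _ σ↭τ)) (↭.↭-length σ↭τ)

∣∣-≤⇒ : (r : Subset V → ℕ) {A B C D : Subset V} →
  ∣ (A , B) ∣[ r ] ℤ.≤ ∣ (C , D) ∣[ r ] → r A + r B ≤ r C + r D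
∣∣-≤⇒ {V} r {A} {B} {C} {D} ∣AB∣≤∣CD∣ =
  ℤ.drop‿+≤+ (subst₂ ℤ._≤_ (add-back (r A + r B)) (add-back (r C + r D))
    (ℤ.+-monoˡ-≤ (ℤ.+ r (Whole V)) ∣AB∣≤∣CD∣))
  where
  minus-plus : ∀ i j → i ℤ.- j ℤ.+ j ≡ i
  minus-plus = ℤ-Solver.solve-∀
  add-back : ∀ k → ℤ.+ k ℤ.- ℤ.+ r (Whole V) ℤ.+ ℤ.+ r (Whole V) ≡ ℤ.+ k
  add-back k = minus-plus (ℤ.+ k) (ℤ.+ r (Whole V))

Fp-resp-↭ : {S : Sep V → Set} {r : Subset V → ℕ} {p : ℕ} {σ τ : List (Sep V)} →
  σ ↭ τ → Fp S r p σ → Fp S r p τ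
Fp-resp-↭ {V} {r = r} σ↭τ (σ⊆S , star , ⟨σ⟩<p) =
  ↭.All-resp-↭ σ↭τ σ⊆S ,
  AllPairs⇒IsStar (↭ₛ.AllPairs-resp-↭ (setoid (Sep V)) ⇄-sym (resp₂ _⇄_) (↭⇒↭ₛ σ↭τ) (IsStar⇒AllPairs star)) ,
  subst (ℤ._< _) (⟨⟩-resp-↭ r σ↭τ) ⟨σ⟩<p

private
  cancel-middle : ∀ {a b c d m} → a ≤ b + m → c + m ≤ d → a + c ≤ b + d
  cancel-middle {a} {b} {c} {d} {m} a≤b+m c+m≤d = ℕ.+-cancelʳ-≤ m _ _ (begin
    a + c + m    ≡⟨ ℕ.+-assoc a c m ⟩
    a + (c + m)  ≤⟨ ℕ.+-mono-≤ a≤b+m c+m≤d ⟩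
    b + m + d    ≡⟨ ℕ.+-assoc b m d ⟩
    b + (m + d)  ≡⟨ cong (b +_) (ℕ.+-comm m d) ⟩
    b + (d + m)  ≡⟨ ℕ.+-assoc b d m ⟨
    b + d + m    ∎)
    where open ℕ.≤-Reasoning

  telescope-step : ∀ u d e o m b c → d + e ≤ o + m → u + m ≤ b + c → u + d + e ≤ b + o + c
  telescope-step u d e o m b c d+e≤o+m u+m≤b+c =
    subst₂ _≤_ (rearrangeˡ d e u) (rearrangeʳ o b c) (cancel-middle d+e≤o+m u+m≤b+c)
    where
    rearrangeˡ : ∀ d e u → d + e + u ≡ u + d + e
    rearrangeˡ = solve-∀
    rearrangeʳ : ∀ o b c → o + (b + c) ≡ b + o + c
    rearrangeʳ = solve-∀

  cancel-crossed : ∀ p q s t c u → p + q ≤ s + t → c + t ≤ q + u → c + p ≤ s + u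
  cancel-crossed p q s t c u p+q≤s+t c+t≤q+u =
    ℕ.+-cancelʳ-≤ q _ _ (subst₂ _≤_ (rearrangeˡ p q c) (rearrangeʳ s q u) (cancel-middle p+q≤s+t c+t≤q+u))
    where
    rearrangeˡ : ∀ p q c → p + q + c ≡ c + p + q
    rearrangeˡ = solve-∀
    rearrangeʳ : ∀ s q u → s + (q + u) ≡ s + u + q
    rearrangeʳ = solve-∀

-- Shifting a star

module Shift {V : Set} (X Y : Subset V) where

  up : Sep V → Sep V
  up σ = σ ∨ˢ (X , Y)

  down : Sep V → Sep V
  down σ = σ ∧ˢ (Y , X)

  down⇄down : {σ τ : Sep V} → σ ⇄ τ → down σ ⇄ down τ
  down⇄down {σ} {τ} σ⇄τ = ≤ˢ-trans (∧ˢ-≤ˡ σ (Y , X)) (≤ˢ-trans σ⇄τ (≤ˢ-∨ˢˡ (τ *) (X , Y)))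

  up⇄down : {σ τ : Sep V} → σ ⇄ τ → up σ ⇄ down τ
  up⇄down = ∨ˢ-monoˡ (X , Y)

  shift-AllPairs : {σ₀ : Sep V} {ρ : List (Sep V)} →
    AllPairs _⇄_ (σ₀ ∷ ρ) → AllPairs _⇄_ (up σ₀ ∷ map down ρ)
  shift-AllPairs (σ₀⇄ρ ∷ ρ!) =
    All.map⁺ (All.map up⇄down σ₀⇄ρ) ∷ AllPairs.map⁺ (AllPairs.map down⇄down ρ!)

  module _ {r : Subset V → ℕ} (rk : IsSubmodularRank r) where
    open IsSubmodularRank rk

    down-step : {A B C : Subset V} → IsSep (A , B) → (A ∩ X) ⊆ C →
      r (B ∪ X) + r (B ∩ C) ≤ r B + r C
    down-step {A} {B} {C} A∪B A∩X⊆C = begin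
      r (B ∪ X) + r (B ∩ C)  ≤⟨ ℕ.+-monoˡ-≤ (r (B ∩ C)) (monotone (B ∪ X) (B ∪ C) B∪X⊆B∪C) ⟩
      r (B ∪ C) + r (B ∩ C)  ≡⟨ ℕ.+-comm (r (B ∪ C)) (r (B ∩ C)) ⟩
      r (B ∩ C) + r (B ∪ C)  ≤⟨ submodular B C ⟩
      r B + r C              ∎
      where
      open ℕ.≤-Reasoning
      B∪X⊆B∪C : (B ∪ X) ⊆ (B ∪ C)
      B∪X⊆B∪C v (inj₁ b) = inj₁ b
      B∪X⊆B∪C v (inj₂ x) with A∪B v
      ... | inj₁ a = inj₂ (A∩X⊆C v (a , x))
      ... | inj₂ b = inj₁ b

    -- Each member (A , B) shrinks C to B ∩ C; the later members A′ ⊆ B keep A′ ∩ X inside it.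
    telescope : (ρ : List (Sep V)) {C E : Subset V} → All IsSep ρ → AllPairs _⇄_ ρ →
      All (λ σ → (proj₁ σ ∩ X) ⊆ C) ρ → All (λ σ → E ⊆ proj₂ σ) ρ → E ⊆ C →
      rightRankSum r (map down ρ) + r E ≤ rightRankSum r ρ + r C
    telescope [] _ _ _ _ E⊆C = monotone _ _ E⊆C
    telescope ((A , B) ∷ ρ) {C} {E} (A∪B ∷ ρ-seps) (σ⇄ρ ∷ ρ!) (A∩X⊆C ∷ ρ∩X⊆C) (E⊆B ∷ E⊆ρ) E⊆C =
      telescope-step (r (B ∪ X)) D (r E) O (r (B ∩ C)) (r B) (r C) IH (down-step A∪B A∩X⊆C)
      where
      D = rightRankSum r (map down ρ)
      O = rightRankSum r ρ
      IH : D + r E ≤ O + r (B ∩ C)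
      IH = telescope ρ ρ-seps ρ!
        (All.zipWith (λ { (σ⇄τ , τ∩X⊆C) v (a , x) → proj₂ σ⇄τ v a , τ∩X⊆C v (a , x) }) (σ⇄ρ , ρ∩X⊆C))
        E⊆ρ (λ v e → E⊆B v e , E⊆C v e)

    shift-rightRankSum-≤ : {σ₀ : Sep V} {ρ : List (Sep V)} → All IsSep ρ → AllPairs _⇄_ (σ₀ ∷ ρ) →
      r (proj₂ σ₀ ∩ Y) + r X ≤ r (X ∩ proj₁ σ₀) + r (proj₂ σ₀) →
      rightRankSum r (up σ₀ ∷ map down ρ) ≤ rightRankSum r (σ₀ ∷ ρ)
    shift-rightRankSum-≤ {A₀ , B₀} {ρ} ρ-seps (σ₀⇄ρ ∷ ρ!) bound =
      subst (r (B₀ ∩ Y) + rightRankSum r (map down ρ) ≤_) (ℕ.+-comm (rightRankSum r ρ) (r B₀))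
        (cancel-crossed (rightRankSum r (map down ρ)) (r (X ∩ A₀)) (rightRankSum r ρ) (r X) (r (B₀ ∩ Y)) (r B₀)
          (telescope ρ ρ-seps ρ! (All.universal (λ _ _ → proj₂) ρ)
            (All.map (λ σ₀⇄σ v (_ , a₀) → proj₁ σ₀⇄σ v a₀) σ₀⇄ρ) (λ _ → proj₁))
          bound)

    module _ {S : Sep V → Set} (U : IsUniverse S) where
      open IsUniverse U

      linked-bound : {a : Sep V} {A₀ B₀ : Subset V} → S (X , Y) → S (A₀ , B₀) →
        Linked-to S r (X , Y) a → a ≤ˢ (A₀ , B₀) → r (B₀ ∩ Y) + r X ≤ r (X ∩ A₀) + r B₀
      linked-bound {A₀ = A₀} {B₀} XY∈S σ₀∈S (a≤XY , XY-minimal) a≤σ₀ =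
        cancel-crossed (r X) (r Y) (r (X ∩ A₀)) (r (B₀ ∪ Y)) (r (B₀ ∩ Y)) (r B₀)
          (subst (λ k → r X + r Y ≤ r (X ∩ A₀) + k) (r-ext _ _ (∪-comm Y B₀)) ∣XY∣≤∣XY∧σ₀∣)
          (subst (r (B₀ ∩ Y) + r (B₀ ∪ Y) ≤_) (ℕ.+-comm (r B₀) (r Y)) (submodular B₀ Y))
        where
        ∪-comm : (A B : Subset V) → (A ∪ B) ≐ (B ∪ A)
        ∪-comm _ _ = (λ _ → Data.Sum.swap) , (λ _ → Data.Sum.swap)
        ∣XY∣≤∣XY∧σ₀∣ : r X + r Y ≤ r (X ∩ A₀) + r (Y ∪ B₀)
        ∣XY∣≤∣XY∧σ₀∣ = ∣∣-≤⇒ r (XY-minimal ((X , Y) ∧ˢ (A₀ , B₀)) (∧-cl _ _ XY∈S σ₀∈S)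
          (∧ˢ-greatest a≤XY a≤σ₀) (∧ˢ-≤ˡ (X , Y) (A₀ , B₀)))

      shift-Fp : {p : ℕ} {a σ₀ : Sep V} {ρ : List (Sep V)} → S (X , Y) →
        Linked-to S r (X , Y) a → a ≤ˢ σ₀ →
        Fp S r p (σ₀ ∷ ρ) → Fp S r p (up σ₀ ∷ map down ρ)
      shift-Fp {σ₀ = σ₀} {ρ} XY∈S linked a≤σ₀ (σ₀∈S ∷ ρ⊆S , star , ⟨σ⟩<p) =
        ∨-cl _ _ σ₀∈S XY∈S ∷ All.map⁺ (All.map (λ σ∈S → ∧-cl _ _ σ∈S (*-cl _ XY∈S)) ρ⊆S) ,
        AllPairs⇒IsStar (shift-AllPairs σ₀∷ρ!) ,
        ℤ.≤-<-trans
          (⟨⟩-mono r {up σ₀ ∷ map down ρ} {σ₀ ∷ ρ} (cong suc (length-map down ρ))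
            (shift-rightRankSum-≤ (All.map (⊆sep _) ρ⊆S) σ₀∷ρ! (linked-bound XY∈S σ₀∈S linked a≤σ₀)))
          ⟨σ⟩<p
        where
        σ₀∷ρ! = IsStar⇒AllPairs star

-- Paths in a tree

module Paths {n : ℕ} (adj : Fin n → Fin n → Bool) (tree : IsTree adj) where
  open IsTree tree
  open import Data.List.Membership.DecPropositional (_≟_ {n}) using (_∈?_)

  _~_ : Fin n → Fin n → Set
  _~_ = Adj adj

  ~-sym : Symmetric _~_
  ~-sym {x} {y} x~y = trans (symmetric y x) x~y

  IsPath-∷ : ∀ {x xs} → x ∉ xs → Connected _~_ (just x) (head xs) → IsPath adj xs → IsPath adj (x ∷ xs)
  IsPath-∷ {xs = xs} x∉xs x~xs (xs! , xs~) = All.¬Any⇒All¬ xs x∉xs ∷ xs! , x~xs ∷′ xs~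

  IsPath-++⁻ : ∀ xs {ys} → IsPath adj (xs ++ ys) → IsPath adj xs × IsPath adj ys
  IsPath-++⁻ xs (xs++ys! , xs++ys~) =
    (proj₁ (AllPairs-++⁻ xs xs++ys!) , proj₁ (Linked-++⁻ xs xs++ys~)) ,
    (proj₂ (proj₂ (AllPairs-++⁻ xs xs++ys!)) , proj₂ (proj₂ (Linked-++⁻ xs xs++ys~)))

  IsPath-++⁺ : ∀ {xs ys} → IsPath adj xs → IsPath adj ys → Disjoint xs ys →
    Connected _~_ (last xs) (head ys) → IsPath adj (xs ++ ys)
  IsPath-++⁺ (xs! , xs~) (ys! , ys~) xs#ys xs~ys = Unique.++⁺ xs! ys! xs#ys , Linked.++⁺ xs~ xs~ys ys~

  IsPath-reverse : ∀ {xs} → IsPath adj xs → IsPath adj (reverse xs)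
  IsPath-reverse {xs} (xs! , xs~) =
    ↭ₛ.Unique-resp-↭ (setoid (Fin n)) (↭⇒↭ₛ (↭-sym (↭.↭-reverse xs))) xs! , Linked-reverse⁺ ~-sym xs~

  cycle-length : ∀ a (P₁ : List (Fin n)) w Q₁ → (P₁ ≡ [] → Q₁ ≡ [] → ⊥) →
    3 ≤ length ((a ∷ P₁) ++ w ∷ reverse Q₁)
  cycle-length a []       w []       nontrivial = ⊥-elim (nontrivial refl refl)
  cycle-length a []       w (q ∷ Q₁) _          =
    s≤s (s≤s (subst (λ l → 1 ≤ length l) (sym (unfold-reverse q Q₁)) (nonempty-length (reverse Q₁) q [])))
  cycle-length a (p ∷ P₁) w Q₁       _          = s≤s (s≤s (nonempty-length P₁ w (reverse Q₁)))

  -- Follow P up to its first vertex w on c ∷ Q, then return to a backwards along Q.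
  fork⇒cycle : ∀ {a P c Q} → IsPath adj (a ∷ P) → IsPath adj (a ∷ c ∷ Q) → head P ≢ just c →
    First.FirstView (_∉ c ∷ Q) (_∈ c ∷ Q) P → HasCycle adj
  fork⇒cycle {a} {c = c} {Q} pathP pathQ P≢Q (First._++_∷_ {P₁} {w} P₁∉Q w∈Q P₂) with ∈-∃++ w∈Q
  ... | Q₁ , Q₂ , c∷Q≡ = a , c , (a ∷ P₁) ++ w ∷ reverse Q₁ , (path , refl , ends-at-c) ,
                          cycle-length a P₁ w Q₁ nontrivial , ~-sym (Linked.head (proj₂ pathQ))
    where
    Q-split : c ∷ Q ≡ (Q₁ ∷ʳ w) ++ Q₂
    Q-split = trans c∷Q≡ (sym (++-assoc Q₁ [ w ] Q₂))
    reverse-Q₁∷ʳw : reverse (Q₁ ∷ʳ w) ≡ w ∷ reverse Q₁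
    reverse-Q₁∷ʳw = reverse-++ Q₁ [ w ]
    Q-back : IsPath adj (w ∷ reverse Q₁)
    Q-back = subst (IsPath adj) reverse-Q₁∷ʳw
      (IsPath-reverse (proj₁ (IsPath-++⁻ (Q₁ ∷ʳ w) (subst (IsPath adj) Q-split (proj₂ (IsPath-++⁻ [ a ] pathQ))))))
    back⊆Q : ∀ {v} → v ∈ w ∷ reverse Q₁ → v ∈ c ∷ Q
    back⊆Q (here refl) = w∈Q
    back⊆Q (there v∈) = subst (_ ∈_) (sym c∷Q≡) (∈-++⁺ˡ (↭.∈-resp-↭ (↭.↭-reverse Q₁) v∈))
    a∉Q : a ∉ c ∷ Q
    a∉Q = All.All¬⇒¬Any (AllPairs.head (proj₁ pathQ))
    path : IsPath adj ((a ∷ P₁) ++ w ∷ reverse Q₁)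
    path = IsPath-++⁺ (proj₁ (IsPath-++⁻ (a ∷ P₁) pathP)) Q-back
      (λ { (here refl , v∈) → a∉Q (back⊆Q v∈) ; (there v∈P₁ , v∈) → All.lookup P₁∉Q v∈P₁ (back⊆Q v∈) })
      (proj₁ (proj₂ (Linked-++⁻ (a ∷ P₁) (proj₂ pathP))))
    ends-at-c : last ((a ∷ P₁) ++ w ∷ reverse Q₁) ≡ just c
    ends-at-c = begin
      last ((a ∷ P₁) ++ w ∷ reverse Q₁)  ≡⟨ last-++-∷ (a ∷ P₁) w (reverse Q₁) ⟩
      last (w ∷ reverse Q₁)              ≡⟨ cong last reverse-Q₁∷ʳw ⟨
      last (reverse (Q₁ ∷ʳ w))           ≡⟨ last-reverse (Q₁ ∷ʳ w) ⟩
      head (Q₁ ∷ʳ w)                     ≡⟨ head-∷ʳ-++ Q₁ w Q₂ ⟨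
      head ((Q₁ ∷ʳ w) ++ Q₂)             ≡⟨ cong head Q-split ⟨
      just c                             ∎
      where open ≡-Reasoning
    nontrivial : P₁ ≡ [] → Q₁ ≡ [] → ⊥
    nontrivial refl refl = P≢Q (cong just (sym (∷-injectiveˡ c∷Q≡)))

  no-fork : ∀ {a b P c Q} → IsPath adj (a ∷ b ∷ P) → IsPath adj (a ∷ c ∷ Q) →
    last (b ∷ P) ≡ last (c ∷ Q) → b ≡ c
  no-fork {b = b} {P} {c} {Q} pathP pathQ same-end with b ≟ c | ∃-last b P
  ... | yes b≡c | _ = b≡c
  ... | no b≢c  | z , ends-at-z = ⊥-elim (acyclic (fork⇒cycle pathP pathQ (b≢c ∘ just-injective)
                                   (first-common _≟_ (∈-last ends-at-z) (∈-last (trans (sym same-end) ends-at-z)))))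

  paths-unique : ∀ {P Q} → IsPath adj P → IsPath adj Q → head P ≡ head Q → last P ≡ last Q → P ≡ Q
  paths-unique {[]}          {[]}          _     _     _    _        = refl
  paths-unique {a ∷ []}      {.a ∷ []}     _     _     refl _        = refl
  paths-unique {a ∷ []}      {.a ∷ c ∷ Q}  _     pathQ refl a≡end    =
    ⊥-elim (All.All¬⇒¬Any (AllPairs.head (proj₁ pathQ)) (∈-last (sym a≡end)))
  paths-unique {a ∷ b ∷ P}   {.a ∷ []}     pathP _     refl end≡a    =
    ⊥-elim (All.All¬⇒¬Any (AllPairs.head (proj₁ pathP)) (∈-last end≡a))
  paths-unique {a ∷ b ∷ P}   {.a ∷ c ∷ Q}  pathP pathQ refl same-end =
    cong (a ∷_) (paths-unique {b ∷ P} {c ∷ Q} (proj₂ (IsPath-++⁻ [ a ] pathP)) (proj₂ (IsPath-++⁻ [ a ] pathQ))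
      (cong just (no-fork pathP pathQ same-end)) same-end)

  IsPath-edge : ∀ {x y} → x ~ y → IsPath adj (x ∷ y ∷ [])
  IsPath-edge {x} x~y =
    IsPath-∷ (λ { (here refl) → irreflexive x x~y ; (there ()) }) (just x~y) ([] ∷ [] , [-])

  module _ {t t' : Fin n} where

    InComp-∈ : ∀ {z u ps} → PathFromTo adj t' z ps → t ∉ ps → u ∈ ps → InComp adj t t' u
    InComp-∈ {u = u} {ps} (path , starts , _) t∉ps u∈ps with ∈-∃++ u∈ps
    ... | P₁ , P₂ , ps≡ =
      P₁ ∷ʳ u ,
      (proj₁ (IsPath-++⁻ (P₁ ∷ʳ u) (subst (IsPath adj) ps≡′ path)) ,
       trans (sym (head-∷ʳ-++ P₁ u P₂)) (trans (cong head (sym ps≡′)) starts) ,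
       last-∷ʳ P₁ u) ,
      λ t∈ → t∉ps (subst (t ∈_) (sym ps≡′) (∈-++⁺ˡ t∈))
      where
      ps≡′ = trans ps≡ (sym (++-assoc P₁ [ u ] P₂))

    InComp-step : ∀ {z x} → InComp adj t t' z → z ~ x → x ≢ t → InComp adj t t' x
    InComp-step {x = x} (ps , from-to@(path , starts , ends) , t∉ps) z~x x≢t with x ∈? ps
    ... | yes x∈ps = InComp-∈ from-to t∉ps x∈ps
    ... | no x∉ps  =
      ps ∷ʳ x ,
      (IsPath-++⁺ path ([] ∷ [] , [-]) (λ { (x∈ps , here refl) → x∉ps x∈ps })
         (subst (λ m → Connected _~_ m (just x)) (sym ends) (just z~x)) ,
       head-++ ps [ x ] starts ,
       last-∷ʳ ps x) ,
      λ t∈ → case∈ (∈-++⁻ ps t∈)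
      where
      case∈ : t ∈ ps ⊎ t ∈ [ x ] → ⊥
      case∈ (inj₁ t∈ps)       = t∉ps t∈ps
      case∈ (inj₂ (here t≡x)) = x≢t (sym t≡x)

  module _ {t t' : Fin n} (t~t' : t ~ t') where

    EdgeLe⇒path : ∀ {u v} → EdgeLe adj (t , t') (u , v) →
      ∃ λ ini → IsPath adj ((ini ∷ʳ u) ∷ʳ v) × head ((ini ∷ʳ u) ∷ʳ v) ≡ just t
    EdgeLe⇒path (inj₁ (refl , refl)) = [] , IsPath-edge t~t' , refl
    EdgeLe⇒path {u} {v} (inj₂ (_ , path , (_ , refl) , (ini , ps≡))) =
      ini , subst (IsPath adj) ps≡′ path , cong head (sym ps≡′)
      where
      ps≡′ = trans ps≡ (sym (++-assoc ini [ u ] [ v ]))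

    EdgeLe-source-unique : ∀ {x y s} → EdgeLe adj (t , t') (x , s) → EdgeLe adj (t , t') (y , s) → x ≡ y
    EdgeLe-source-unique {x} {y} {s} t′→x→s t′→y→s with EdgeLe⇒path t′→x→s | EdgeLe⇒path t′→y→s
    ... | ini , path , starts | ini′ , path′ , starts′ =
      proj₂ (∷ʳ-injective ini ini′ (proj₁ (∷ʳ-injective (ini ∷ʳ x) (ini′ ∷ʳ y)
        (paths-unique path path′ (trans starts (sym starts′))
          (trans (last-∷ʳ (ini ∷ʳ x) s) (sym (last-∷ʳ (ini′ ∷ʳ y) s)))))))

    -- The second path, cut at s, is the path from t to s, which already passes through x.
    EdgeLe-one-way : ∀ {x s} → EdgeLe adj (t , t') (x , s) → EdgeLe adj (t , t') (s , x) → ⊥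
    EdgeLe-one-way {x} {s} t′→x→s t′→s→x with EdgeLe⇒path t′→x→s | EdgeLe⇒path t′→s→x
    ... | ini , path , starts | ini′ , path′ , starts′ =
      All.head (All.lookup (proj₁ (proj₂ (AllPairs-++⁻ (ini′ ∷ʳ s) (proj₁ path′)))) x∈ini′∷ʳs) refl
      where
      to-s : (ini ∷ʳ x) ∷ʳ s ≡ ini′ ∷ʳ s
      to-s = paths-unique path (proj₁ (IsPath-++⁻ (ini′ ∷ʳ s) path′))
        (trans starts (trans (sym starts′) (head-∷ʳ-++ ini′ s [ x ])))
        (trans (last-∷ʳ (ini ∷ʳ x) s) (sym (last-∷ʳ ini′ s)))
      x∈ini′∷ʳs : x ∈ ini′ ∷ʳ s
      x∈ini′∷ʳs = ∈-++⁺ˡ (subst (x ∈_) (proj₁ (∷ʳ-injective (ini ∷ʳ x) ini′ to-s)) (∈-++⁺ʳ ini (here refl)))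

    neighbour-EdgeT : ∀ {s x} → InComp adj t t' s → x ~ s → EdgeT adj t t' x s
    neighbour-EdgeT {s} {x} s∈T x~s with x ≟ t
    ... | no x≢t   = x~s , inj₁ (InComp-step s∈T (~-sym x~s) x≢t , s∈T)
    ... | yes refl = x~s , inj₂ (inj₁ (refl , s≡t′ s∈T))
      where
      s≡t′ : InComp adj t t' s → s ≡ t'
      s≡t′ (y ∷ rest , (path , refl , ends) , t∉ps) =
        ∷-injectiveˡ (∷-injectiveʳ (paths-unique (IsPath-edge x~s) (IsPath-∷ t∉ps (just t~t') path) refl (sym ends)))

    entering-edge : ∀ {s} → InComp adj t t' s → ∃ λ x₀ → EdgeLe adj (t , t') (x₀ , s) × EdgeT adj t t' x₀ s
    entering-edge {s} s∈T@(y ∷ rest , (path , refl , ends) , t∉ps)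
      with last-view {xs = y ∷ rest} ends
    ... | ys , ps≡ with ∃-last t ys
    ...   | u , t∷ys-ends with last-view {xs = t ∷ ys} t∷ys-ends
    ...     | ini , t∷ys≡ = u , inj₂ (t ∷ t' ∷ rest , full-path , (rest , refl) , (ini , split′)) , u~s , classify ini split
      where
      full-path : IsPath adj (t ∷ t' ∷ rest)
      full-path = IsPath-∷ t∉ps (just t~t') path
      split : t ∷ t' ∷ rest ≡ (ini ∷ʳ u) ∷ʳ s
      split = trans (cong (t ∷_) ps≡) (cong (_∷ʳ s) t∷ys≡)
      split′ : t ∷ t' ∷ rest ≡ ini ++ u ∷ s ∷ []
      split′ = trans split (++-assoc ini [ u ] [ s ])
      u~s : u ~ s
      u~s = drop-just (subst (λ m → Connected _~_ m (just s)) (last-∷ʳ ini u)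
        (proj₁ (proj₂ (Linked-++⁻ (ini ∷ʳ u) (proj₂ (subst (IsPath adj) split full-path))))))
      classify : ∀ ini → t ∷ t' ∷ rest ≡ (ini ∷ʳ u) ∷ʳ s →
        (InComp adj t t' u × InComp adj t t' s) ⊎ (u ≡ t × s ≡ t') ⊎ (u ≡ t' × s ≡ t)
      classify []         eq = inj₂ (inj₁ (sym (∷-injectiveˡ eq) , sym (∷-injectiveˡ (∷-injectiveʳ eq))))
      classify (_ ∷ ini′) eq =
        inj₁ (InComp-∈ (path , refl , ends) t∉ps
                (subst (u ∈_) (sym (∷-injectiveʳ eq)) (∈-++⁺ˡ (∈-++⁺ʳ ini′ (here refl)))) , s∈T)

-- Tame S-trees

module TameTree {V : Set} {S : Sep V → Set} {n : ℕ} {adj : Fin n → Fin n → Bool} {α : Fin n → Fin n → Sep V}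
                (tame-tree : IsTameSTree S adj α) where
  open IsTameSTree tame-tree
  open Paths adj tree public

  ∈-nbrs : ∀ {x b} → x ~ b → x ∈ nbrs adj b
  ∈-nbrs {x} {b} x~b = ∈-filter⁺ (T? ∘ λ y → adj y b) (∈-allFin x) (Equivalence.from T-≡ x~b)

  nbrs-~ : ∀ {x b} → x ∈ nbrs adj b → x ~ b
  nbrs-~ {b = b} x∈ = Equivalence.to T-≡ (proj₂ (∈-filter⁻ (T? ∘ λ y → adj y b) {xs = allFin n} x∈))

  neighbours-⇄ : ∀ {b x y} → x ≢ y → x ~ b → y ~ b → α x b ⇄ α y b
  neighbours-⇄ {b} x≢y x~b y~b =
    AllPairs-∈ ⇄-sym (AllPairs.map⁻ (IsStar⇒AllPairs (tame b))) (∈-nbrs x~b) (∈-nbrs y~b) x≢y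

  α-mono-path : ∀ ini {a b l u v} → IsPath adj (a ∷ b ∷ l) → a ∷ b ∷ l ≡ ini ++ u ∷ v ∷ [] → α a b ≤ˢ α u v
  α-mono-path []        _ refl = ≤ˢ-refl
  α-mono-path (_ ∷ ini) {l = []} _ eq = ⊥-elim (singleton≢++-pair ini (∷-injectiveʳ eq))
  α-mono-path (_ ∷ ini) {a} {b} {d ∷ _} path@((_ ∷ a≢d ∷ _) ∷ _ , a~b ∷ b~d ∷ _) eq =
    ≤ˢ-trans (subst (α a b ≤ˢ_) (sym (invol d b (~-sym b~d))) (neighbours-⇄ a≢d a~b (~-sym b~d)))
             (α-mono-path ini (proj₂ (IsPath-++⁻ [ a ] path)) (∷-injectiveʳ eq))

  α-mono : ∀ {x y u v} → EdgeLe adj (x , y) (u , v) → α x y ≤ˢ α u v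
  α-mono (inj₁ (refl , refl))                           = ≤ˢ-refl
  α-mono (inj₂ (_ , path , (_ , refl) , (ini , split))) = α-mono-path ini path split

lemma2p13 : {V : Set} (S : Sep V → Set) (r : Subset V → ℕ) (p : ℕ) →
    IsUniverse S → IsSubmodularRank r →
    {n : ℕ} (adj : Fin n → Fin n → Bool) (α : Fin n → Fin n → Sep V) →
    IsTameSTree S adj α →
    (t t' : Fin n) → Adj adj t t' →
    (s : Fin n) → VT adj t t' s → s ≢ t →
    Fp S r p (σ[ adj , α ] s) →
    (XY : Sep V) → S XY → Linked-to S r XY (α t t') →
    (xs : List (Fin n)) → Unique xs →
    (∀ x → x ∈ xs → EdgeT adj t t' x s) → (∀ x → EdgeT adj t t' x s → x ∈ xs) →
    (L : List (Sep V)) → Pointwise (λ x σ → ShiftVal adj α t t' XY x s σ) xs L →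
    Fp S r p L
lemma2p13 {V} S r p U rk {n} adj α tame-tree t t' t~t' s s∈T s≢t σₛ∈Fp XY XY∈S linked
          xs xs! xs⊆T T⊆xs L shifted =
  Fp-resp-↭ (↭-sym L↭)
    (subst (Fp S r p) (cong (up (β x₀) ∷_) (sym (map-∘ zs)))
      (shift-Fp rk U XY∈S linked (α-mono t→x₀s)
        (Fp-resp-↭ (↭.map⁺ β (↭-trans (↭-sym xs↭nbrs) xs↭)) σₛ∈Fp)))
  where
  open TameTree tame-tree
  open Shift (proj₁ XY) (proj₂ XY)
  β : Fin n → Sep V
  β x = α x s
  s∈T′ : InComp adj t t' s
  s∈T′ = Data.Sum.[ ⊥-elim ∘ s≢t , id ] s∈T
  xs↭nbrs : xs ↭ nbrs adj s
  xs↭nbrs = ∼bag⇒↭ (unique∧set⇒bag xs! (Unique.filter⁺ _ (Unique.allFin⁺ n))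
    (mk⇔ (∈-nbrs ∘ proj₁ ∘ xs⊆T _) (T⊆xs _ ∘ neighbour-EdgeT t~t' s∈T′ ∘ nbrs-~)))
  entering : ∃ λ x₀ → EdgeLe adj (t , t') (x₀ , s) × EdgeT adj t t' x₀ s
  entering = entering-edge t~t' s∈T′
  x₀ = proj₁ entering
  t→x₀s = proj₁ (proj₂ entering)
  normalise : ∀ {x σ} → ShiftVal adj α t t' XY x s σ → (x ≡ x₀ × σ ≡ up (β x)) ⊎ (x ≢ x₀ × σ ≡ down (β x))
  normalise (inj₁ (t→xs , σ≡)) = inj₁ (EdgeLe-source-unique t~t' t→xs t→x₀s , σ≡)
  normalise (inj₂ (t→sx , σ≡)) = inj₂ ((λ { refl → EdgeLe-one-way t~t' t→x₀s t→sx }) , σ≡)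
  pivot = pivot-↭ (T⊆xs x₀ (proj₂ (proj₂ entering))) xs! (Pointwise.map normalise shifted)
  zs = proj₁ pivot
  xs↭ = proj₁ (proj₂ pivot)
  L↭ = proj₂ (proj₂ pivot)
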